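{- Every automata cascade $C$ that is an automaton on assignments admits an equivalent program $P$: the input variables of $C$ are input variables of $P$, its output variables are variables of $P$, and for every input string (interpretation) $I$, every time point $t$ and every output variable $a$ of $C$, $(C,I,t)\vdash a$ if and only if $(P,I,t)\models a$.
   Context: Write $\mathbb{B}=\{0,1\}$. Static formulas are built from propositional variables and the constants $\top,\bot$ using $\neg,\land,\lor$. An operator automaton is a tuple $\mathcal{A}=\langle \mathbb{B}^m,[1,n],\delta,q_{\mathrm{init}}\rangle$ with $\delta:[1,n]\times\mathbb{B}^m\to[1,n]$ and $q_{\mathrm{init}}\in[1,n]$. A static rule is $p \;{:}{ - }\; \alpha$ ($p$ a variable, $\alpha$ a static formula); a delay rule is $p \;{:}{ - }\; \ominus q$; a dynamic rule is $p_1,\dots,p_n \;{:}{ - }\; \mathcal{A}(a_1,\dots,a_m)$ with $\mathcal{A}$ an operator automaton of input arity $m$ and output arity $n$. A program is a finite set of rules that is nonrecursive (the graph with an edge from $a$ to $b$ whenever $a$ occurs in the body and $b$ in the head of some rule is acyclic) and definitorial (each variable occurs in a head at most once). Variables defined by no rule are input variables. An interpretation is a finite non-empty sequence $I=I_1,\dots,I_\ell$ of subsets of the input variables. Satisfaction $(P,I,t)\models\cdot$: $\top$ holds, $\bot$ does not; an input variable $a$ holds iff $a\in I_t$; $\neg,\land,\lor$ as usual; $p$ defined by $p\;{:}{ - }\;\alpha$ holds iff $(P,I,t)\models\alpha$; $p$ defined by $p\;{:}{ - }\;\ominus q$ holds iff $(P,I,t-1)\models q$; for $p_i$ defined by the dynamic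 rule above, $(P,I,0)\models p_i$ iff $q_{\mathrm{init}}=i$, and for $t>0$, $(P,I,t)\models p_i$ iff there are $j$ and an assignment $\sigma\in\mathbb{B}^m$ to $(a_1,\dots,a_m)$ with $\delta(j,\sigma)=i$, $(P,I,t-1)\models p_j$ and $(P,I,t)\models\sigma$ (assignment identified with the conjunction of literals it makes true). An automaton is $A=\langle\Sigma,Q,\delta,q_{\mathrm{init}},\Gamma,\theta\rangle$ with $\delta:Q\times\Sigma\to Q$, $\theta:Q\times\Sigma\to\Gamma$; on input $\sigma_1\dots\sigma_\ell$ its states are $q_0=q_{\mathrm{init}}$, $q_i=\delta(q_{i-1},\sigma_i)$ and upon reading $\sigma_i$ it outputs $\theta(q_{i-1},\sigma_i)$. An automaton on assignments has $\Sigma=\mathbb{B}^m$, $\Gamma=\mathbb{B}^k$, read as assignments to ordered input variables and ordered output variables $b_1,\dots,b_k$; a string over $\mathbb{B}^m$ is identified with an interpretation, and $(A,I,t)\vdash b_i$ means the output upon reading the $t$-th letter assigns $1$ to $b_i$. An automata cascade $A_1\ltimes\dots\ltimes A_d$ of automata $A_i=\langle\Sigma_i,Q_i,\delta_i,q^{\mathrm{init}}_i,\Gamma_i,\theta_i\rangle$ with $\Sigma_i=\Sigma\times\Gamma_1\times\dots\times\Gamma_{i-1}$ is the automaton with input alphabet $\Sigma$, states $Q_1\times\dots\times Q_d$, initial state $\langle q^{\mathrm{init}}_1,\dots,q^{\mathrm{init}}_d\rangle$, transition $\delta(\langle q_1,\dots,q_d\rangle,\sigma)=\langle\delta_1(q_1,\sigma_1),\dots,\delta_d(q_d,\sigma_d)\rangle$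 where $\sigma_i=\langle\sigma,\theta_1(q_1,\sigma_1),\dots,\theta_{i-1}(q_{i-1},\sigma_{i-1})\rangle$, and output $\theta_d(q_d,\sigma_d)\in\Gamma_d$. -}

module Defs where

open import Data.Nat using (ℕ; zero; suc; _≤_)
open import Data.Bool using (Bool; true; false; not; _∧_; _∨_)
open import Data.Fin using (Fin; _≟_)
open import Data.Vec using (Vec; lookup; toList; tabulate)
open import Data.List using (List; []; _∷_; _++_; concatMap)
open import Data.List.Membership.Propositional using (_∈_; _∉_)
open import Data.List.Relation.Unary.Unique.Propositional using (Unique)
open import Data.Product using (Σ-syntax; ∃-syntax; _×_; _,_; proj₁; proj₂)
open import Data.Unit using (⊤; tt)
open import Relation.Nullary using (¬_)
open import Relation.Nullary.Decidable using (⌊_⌋)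
open import Relation.Binary.PropositionalEquality using (_≡_)
open import Relation.Binary.Construct.Closure.Transitive using (TransClosure)
open import Function.Bundles using (_⇔_)

-- Propositional variables are natural numbers (an infinite supply, so
-- that programs may use auxiliary variables).

Var : Set
Var = ℕ

data Form : Set where
  var  : Var → Form
  tt𝔽  : Form
  ff𝔽  : Form
  neg  : Form → Form
  and  : Form → Form → Form
  or   : Form → Form → Form

formVars : Form → List Var
formVars (var p)   = p ∷ []
formVars tt𝔽       = []
formVars ff𝔽       = []
formVars (neg α)   = formVars α
formVars (and α β) = formVars α ++ formVars β
formVars (or α β)  = formVars α ++ formVars β

eval : (Var → Bool) → Form → Bool
eval ρ (var p)   = ρ p
eval ρ tt𝔽       = true
eval ρ ff𝔽       = false
eval ρ (neg α)   = not (eval ρ α)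
eval ρ (and α β) = eval ρ α ∧ eval ρ β
eval ρ (or α β)  = eval ρ α ∨ eval ρ β

-- Operator automata ⟨𝔹^m, [1,n], δ, q_init⟩  (states [1,n] as Fin n)

record OpAut (m n : ℕ) : Set where
  field
    δ     : Fin n → Vec Bool m → Fin n
    qinit : Fin n

data Rule : Set where
  static  : Var → Form → Rule
  delay   : Var → Var → Rule
  dynamic : ∀ {m n} → OpAut m n → Vec Var n → Vec Var m → Rule

heads : Rule → List Var
heads (static p _)       = p ∷ []
heads (delay p _)        = p ∷ []
heads (dynamic _ ps _)   = toList ps

body : Rule → List Var
body (static _ α)        = formVars α
body (delay _ q)         = q ∷ []
body (dynamic _ _ as)    = toList as

Program : Set
Program = List Rule

allHeads : Program → List Var
allHeads = concatMap heads

vars : Program → List Var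
vars P = concatMap (λ r → heads r ++ body r) P

Edge : Program → Var → Var → Set
Edge P a b = ∃[ r ] (r ∈ P × a ∈ body r × b ∈ heads r)

Nonrecursive : Program → Set
Nonrecursive P = ∀ a → ¬ TransClosure (Edge P) a a

Definitorial : Program → Set
Definitorial P = Unique (allHeads P)

IsProgram : Program → Set
IsProgram P = Nonrecursive P × Definitorial P

IsInput : Program → Var → Set
IsInput P a = a ∉ allHeads P

-- Interpretations: I t is the set I_t (as a characteristic function),
-- meaningful for t ≥ 1 and for input variables only.

Interp : Set
Interp = ℕ → Var → Bool

Holds : ∀ {m} → (Var → Bool) → Vec Var m → Vec Bool m → Set
Holds ρ as σ = ∀ k → ρ (lookup as k) ≡ lookup σ k

-- v is a model of P on I: v t a is the truth value of a at time t, and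
-- all the clauses of the satisfaction relation hold.  (Time 0: input
-- variables and delayed variables are false, since I_0 and time -1 do
-- not exist.)
RuleSem : (v : ℕ → Var → Bool) → Rule → Set
RuleSem v (static p α) = ∀ t → v t p ≡ eval (v t) α
RuleSem v (delay p q) = (v 0 p ≡ false) × (∀ t → v (suc t) p ≡ v t q)
RuleSem v (dynamic {m} {n} A ps as) =
  ∀ (i : Fin n) →
    (v 0 (lookup ps i) ≡ ⌊ OpAut.qinit A ≟ i ⌋) ×
    (∀ t → (v (suc t) (lookup ps i) ≡ true) ⇔
             (∃[ j ] ∃[ σ ] (OpAut.δ A j σ ≡ i × v t (lookup ps j) ≡ true
                              × Holds (v (suc t)) as σ)))

Model : Program → Interp → (ℕ → Var → Bool) → Set
Model P I v =
  (∀ a → IsInput P a → v 0 a ≡ false × (∀ t → v (suc t) a ≡ I (suc t) a)) ×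
  (∀ r → r ∈ P → RuleSem v r)

-- (P, I, t) ⊨ a : a is true at t in the (unique, for programs) model.
Sat : Program → Interp → ℕ → Var → Set
Sat P I t a = ∀ v → Model P I v → v t a ≡ true

record Automaton (S G : Set) : Set₁ where
  field
    Q     : Set
    δ     : Q → S → Q
    qinit : Q
    θ     : Q → S → G

record FinAutomaton (S G : Set) : Set where
  field
    nQ    : ℕ
    δ     : Fin nQ → S → Fin nQ
    qinit : Fin nQ
    θ     : Fin nQ → S → G

toAut : ∀ {S G} → FinAutomaton S G → Automaton S G
toAut A = record { Q = Fin nQ ; δ = δ ; qinit = qinit ; θ = θ }
  where open FinAutomaton A

-- state reached after reading the first t letters of w (letters w 1, w 2, ...)
stateAt : ∀ {S G} (A : Automaton S G) → (ℕ → S) → ℕ → Automaton.Q A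
stateAt A w zero    = Automaton.qinit A
stateAt A w (suc t) = Automaton.δ A (stateAt A w t) (w (suc t))

-- output upon reading the t-th letter (t ≥ 1)
outAt : ∀ {S G} (A : Automaton S G) → (ℕ → S) → ℕ → G
outAt A w t = Automaton.θ A (stateAt A w (Data.Nat.pred t)) (w t)
  where import Data.Nat

-- A prefix `Casc S G` of components whose tuple of outputs has type G;
-- component i has input alphabet S × (Γ₁ × ... × Γ_{i-1}) (nested pairs)
-- and finite output alphabet Γ_i = Fin g.

data Casc (S : Set) : Set → Set₁ where
  nil  : Casc S ⊤
  snoc : ∀ {G g} → Casc S G → FinAutomaton (S × G) (Fin g) → Casc S (G × Fin g)

CState : ∀ {S G} → Casc S G → Set
CState nil        = ⊤
CState (snoc c A) = CState c × Fin (FinAutomaton.nQ A)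

cinit : ∀ {S G} (c : Casc S G) → CState c
cinit nil        = tt
cinit (snoc c A) = cinit c , FinAutomaton.qinit A

cstep : ∀ {S G} (c : Casc S G) → CState c → S → CState c × G
cstep nil tt σ = tt , tt
cstep (snoc c A) (s , q) σ =
  let r = cstep c s σ
      σi = σ , proj₂ r
  in (proj₁ r , FinAutomaton.δ A q σi) , (proj₂ r , FinAutomaton.θ A q σi)

-- a cascade A₁ ⋉ ... ⋉ A_d (d ≥ 1) with input alphabet S and output Γ_d = G
Cascade : Set → Set → Set₁
Cascade S G = Σ[ H ∈ Set ] (Casc S H × FinAutomaton (S × H) G)

cascade : ∀ {S G} → Cascade S G → Automaton S G
cascade (H , c , A) = record
  { Q     = CState c × Fin (FinAutomaton.nQ A)
  ; δ     = λ { (s , q) σ → proj₁ (cstep c s σ) ,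
                            FinAutomaton.δ A q (σ , proj₂ (cstep c s σ)) }
  ; qinit = cinit c , FinAutomaton.qinit A
  ; θ     = λ { (s , q) σ → FinAutomaton.θ A q (σ , proj₂ (cstep c s σ)) }
  }

-- Automata on assignments: input letters are assignments to the ordered
-- input variables ins, outputs assignments to ordered outputs b₁..b_k.

word : ∀ {m} → Vec Var m → Interp → ℕ → Vec Bool m
word ins I t = tabulate (λ j → I t (lookup ins j))

Derives : ∀ {m k} → Automaton (Vec Bool m) (Vec Bool k) → Vec Var m →
          Interp → ℕ → Fin k → Set
Derives A ins I t i = lookup (outAt A (word ins I) t) i ≡ true

-- A cascade is just a finite-state automaton on assignments, and any such automaton A can
-- be simulated by a program with one dynamic rule.  Let A⁺ be A extended to remember its
-- last output; enumerate its finitely many states as x = 1, …, n, and let a fresh variable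
-- p_x hold exactly when A⁺ is in state x.  The operator automaton of the dynamic rule is
-- A⁺ read through this enumeration, so its head variables are one-hot on the current
-- state, and each output variable b_i is defined statically as the disjunction of the p_x
-- over the states x whose remembered output sets b_i.  By induction on time, every model
-- of this program is one-hot on the run of A⁺, and the valuation read off that run is a
-- model; so b_i holds at t exactly when the output of A upon the t-th letter sets it.
module Submission where

open import Defs
open import Data.Nat using (ℕ; zero; suc; _+_; _*_; _≤_; _<_; z≤n; s≤s)
open import Data.Nat.Properties using (+-cancelˡ-≡; m≤m+n; <-trans; <-irrefl; <-≤-trans)
open import Data.Bool using (Bool; true; false)
open import Data.Bool.Properties using (∨-identityʳ)
open import Data.Fin using (Fin; toℕ) renaming (zero to fzero; suc to fsuc)
open import Data.Fin.Properties using (_≟_; toℕ-injective; 1↔⊤; 2↔Bool; *↔×)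
open import Data.Vec using (Vec; []; _∷_; lookup; toList; tabulate; uncons; replicate)
open import Data.Vec.Properties using (lookup∘tabulate; tabulate∘lookup; tabulate-cong)
open import Data.Vec.Membership.Propositional.Properties using (∈-lookup; ∈-toList⁺; ∈-toList⁻)
open import Data.Vec.Membership.Propositional using () renaming (_∈_ to _∈ᵛ_; _∉_ to _∉ᵛ_)
open import Data.Vec.Membership.DecPropositional Data.Nat._≟_ using (_∈?_)
import Data.Vec.Relation.Unary.Any as Anyᵛ
open import Data.Vec.Relation.Unary.Any.Properties using (lookup-index)
import Data.Vec.Relation.Unary.All.Properties as Allᵛ
import Data.Vec.Relation.Unary.Unique.Propositional as Uniqueᵛ
import Data.Vec.Relation.Unary.Unique.Propositional.Properties as Uniqueᵛ
open import Data.List using (List; _++_) renaming ([] to []ˡ; _∷_ to _∷ˡ_)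
open import Data.List.Extrema.Nat using (max; xs≤max)
open import Data.List.Membership.Propositional using (_∈_; _∉_)
open import Data.List.Membership.Propositional.Properties
  using (∈-++⁺ˡ; ∈-++⁺ʳ; ∈-++⁻; ∈-concatMap⁺; ∈-concatMap⁻)
open import Data.List.Relation.Unary.Any using (here; there)
import Data.List.Relation.Unary.Any as Any
import Data.List.Relation.Unary.All as All
open import Data.List.Relation.Unary.AllPairs using () renaming ([] to []ᵖ; _∷_ to _∷ᵖ_)
open import Data.Vec.Relation.Unary.AllPairs using () renaming ([] to []ᵖᵛ; _∷_ to _∷ᵖᵛ_)
open import Data.List.Relation.Unary.Unique.Propositional using (Unique)
import Data.List.Relation.Unary.Unique.Propositional.Properties as Unique
open import Data.Product using (∃-syntax; _×_; _,_; proj₁; proj₂)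
open import Data.Product.Function.NonDependent.Propositional using (_×-↔_)
open import Data.Sum using (inj₁; inj₂; [_,_]′)
open import Data.Unit using (⊤; tt)
open import Function using (_∘_)
open import Function.Bundles using (_↔_; _⇔_; mk⇔; mk↔ₛ′; Inverse; Equivalence)
open import Function.Properties.Inverse using (↔-refl; ↔-trans)
import Function.Properties.Equivalence as ⇔
open import Relation.Nullary using (Dec; yes; no; contradiction)
open import Relation.Nullary.Decidable using (⌊_⌋; ⌊⌋-map′)
open import Relation.Binary.Construct.Closure.Transitive using (TransClosure; [_]; _∷_)
open import Relation.Binary.PropositionalEquality using (_≡_; refl; sym; trans; cong; subst)

private
  variable
    A B : Set
    n : ℕ

Finite : Set → Set
Finite A = ∃[ n ] (Fin n ↔ A)

↔-finite : A ↔ B → Finite A → Finite B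
↔-finite e (n , f) = n , ↔-trans f e

⊤-finite : Finite ⊤
⊤-finite = 1 , 1↔⊤

Bool-finite : Finite Bool
Bool-finite = 2 , 2↔Bool

Fin-finite : Finite (Fin n)
Fin-finite {n} = n , ↔-refl

×-finite : Finite A → Finite B → Finite (A × B)
×-finite (m , f) (n , g) = m * n , ↔-trans *↔× (f ×-↔ g)

Vec-finite : Finite A → ∀ n → Finite (Vec A n)
Vec-finite _ zero = ↔-finite (mk↔ₛ′ (λ _ → []) (λ _ → tt) (λ { [] → refl }) (λ _ → refl)) ⊤-finite
Vec-finite {A} fin (suc n) = ↔-finite ×↔∷ (×-finite fin (Vec-finite fin n))
  where
  ×↔∷ : (A × Vec A n) ↔ Vec A (suc n)
  ×↔∷ = mk↔ₛ′ (λ (x , xs) → x ∷ xs) uncons (λ { (_ ∷ _) → refl }) (λ _ → refl)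

CState-finite : ∀ {S G} (c : Casc S G) → Finite (CState c)
CState-finite nil        = ⊤-finite
CState-finite (snoc c _) = ×-finite (CState-finite c) Fin-finite

cascade-finite : ∀ {S G} (C : Cascade S G) → Finite (Automaton.Q (cascade C))
cascade-finite (_ , c , _) = ×-finite (CState-finite c) Fin-finite

module _ {S G : Set} (A : Automaton S G) where
  open Automaton A

  withLastOutput : G → Automaton S G
  withLastOutput g₀ = record
    { Q     = Q × G
    ; δ     = λ (q , _) σ → δ q σ , θ q σ
    ; qinit = qinit , g₀
    ; θ     = λ (q , _) σ → θ q σ
    }

  state-withLastOutput : ∀ g₀ w t → proj₁ (stateAt (withLastOutput g₀) w t) ≡ stateAt A w t
  state-withLastOutput g₀ w zero    = refl
  state-withLastOutput g₀ w (suc t) = cong (λ q → δ q (w (suc t))) (state-withLastOutput g₀ w t)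

  lastOutput-withLastOutput : ∀ g₀ w t → proj₂ (stateAt (withLastOutput g₀) w (suc t)) ≡ outAt A w (suc t)
  lastOutput-withLastOutput g₀ w t = cong (λ q → θ q (w (suc t))) (state-withLastOutput g₀ w t)

opRun : ∀ {m} → OpAut m n → (ℕ → Vec Bool m) → ℕ → Fin n
opRun 𝒜 w zero    = OpAut.qinit 𝒜
opRun 𝒜 w (suc t) = OpAut.δ 𝒜 (opRun 𝒜 w t) (w (suc t))

module _ {m G} (A : Automaton (Vec Bool m) G) (e : Fin n ↔ Automaton.Q A) where
  open Automaton A
  open Inverse e

  enumerate : OpAut m n
  enumerate = record { δ = λ x σ → from (δ (to x) σ) ; qinit = from qinit }

  to-opRun-enumerate : ∀ w t → to (opRun enumerate w t) ≡ stateAt A w t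
  to-opRun-enumerate w zero    = strictlyInverseˡ qinit
  to-opRun-enumerate w (suc t) = trans (strictlyInverseˡ _) (cong (λ q → δ q (w (suc t))) (to-opRun-enumerate w t))

⌊⌋≡true⇔ : (a? : Dec A) → (⌊ a? ⌋ ≡ true) ⇔ A
⌊⌋≡true⇔ (yes a)  = mk⇔ (λ _ → a) (λ _ → refl)
⌊⌋≡true⇔ (no ¬a) = mk⇔ (λ ()) (λ a → contradiction a ¬a)

≡⌊⌋ : (b : Bool) (a? : Dec A) → (b ≡ true) ⇔ A → b ≡ ⌊ a? ⌋
≡⌊⌋ true  (yes _)  _   = refl
≡⌊⌋ true  (no ¬a) b⇔a = contradiction (Equivalence.to b⇔a refl) ¬a
≡⌊⌋ false (yes a)  b⇔a = Equivalence.from b⇔a a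
≡⌊⌋ false (no _)   _   = refl

constant : Bool → Form
constant true  = tt𝔽
constant false = ff𝔽

eval-constant : ∀ ρ b → eval ρ (constant b) ≡ b
eval-constant ρ true  = refl
eval-constant ρ false = refl

formVars-constant : ∀ b {a} → a ∉ formVars (constant b)
formVars-constant true  ()
formVars-constant false ()

select : (Fin n → Var) → (Fin n → Bool) → Form
select {zero}  p g = ff𝔽
select {suc n} p g = or (and (var (p fzero)) (constant (g fzero))) (select (p ∘ fsuc) (g ∘ fsuc))

eval-select-off : ∀ ρ (p : Fin n → Var) g → (∀ x → ρ (p x) ≡ false) → eval ρ (select p g) ≡ false
eval-select-off {zero}  ρ p g off = refl
eval-select-off {suc n} ρ p g off rewrite off fzero = eval-select-off ρ (p ∘ fsuc) (g ∘ fsuc) (off ∘ fsuc)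

eval-select-oneHot : ∀ ρ (p : Fin n → Var) g y →
  (∀ x → ρ (p x) ≡ ⌊ y ≟ x ⌋) → eval ρ (select p g) ≡ g y
eval-select-oneHot ρ p g fzero oneHot
  rewrite oneHot fzero | eval-constant ρ (g fzero) | eval-select-off ρ (p ∘ fsuc) (g ∘ fsuc) (oneHot ∘ fsuc)
  = ∨-identityʳ (g fzero)
eval-select-oneHot ρ p g (fsuc y) oneHot rewrite oneHot fzero =
  eval-select-oneHot ρ (p ∘ fsuc) (g ∘ fsuc) y (λ x → trans (oneHot (fsuc x)) (⌊⌋-map′ _ _ (y ≟ x)))

formVars-select : ∀ (p : Fin n → Var) g {a} → a ∈ formVars (select p g) → ∃[ x ] (a ≡ p x)
formVars-select {suc n} p g a∈ with ∈-++⁻ (formVars (and (var (p fzero)) (constant (g fzero)))) a∈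
... | inj₁ (here a≡p0) = fzero , a≡p0
... | inj₁ (there a∈c) = contradiction a∈c (formVars-constant (g fzero))
... | inj₂ a∈rest      = let x , a≡px = formVars-select (p ∘ fsuc) (g ∘ fsuc) a∈rest in fsuc x , a≡px

Unique-++⁻ʳ : ∀ (xs : List A) {ys} → Unique (xs ++ ys) → Unique ys
Unique-++⁻ʳ []ˡ        u         = u
Unique-++⁻ʳ (_ ∷ˡ xs) (_ ∷ᵖ u) = Unique-++⁻ʳ xs u

Unique-++⇒disjoint : ∀ (xs : List A) {ys a} → Unique (xs ++ ys) → a ∈ xs → a ∉ ys
Unique-++⇒disjoint (_ ∷ˡ xs) (x∉ ∷ᵖ _) (here refl) a∈ys = All.lookup x∉ (∈-++⁺ʳ xs a∈ys) refl
Unique-++⇒disjoint (_ ∷ˡ xs) (_ ∷ᵖ u)  (there a∈xs) = Unique-++⇒disjoint xs u a∈xs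

Unique-toList⁻ : {xs : Vec A n} → Unique (toList xs) → Uniqueᵛ.Unique xs
Unique-toList⁻ {xs = []}     _         = []ᵖᵛ
Unique-toList⁻ {xs = _ ∷ _} (x∉ ∷ᵖ u) = Allᵛ.toList⁻ x∉ ∷ᵖᵛ Unique-toList⁻ u

Unique-toList⁺ : {xs : Vec A n} → Uniqueᵛ.Unique xs → Unique (toList xs)
Unique-toList⁺ {xs = []}     _          = []ᵖ
Unique-toList⁺ {xs = _ ∷ _} (x∉ ∷ᵖᵛ u) = Allᵛ.toList⁺ x∉ ∷ᵖ Unique-toList⁺ u

lookup∈toList : (xs : Vec A n) (i : Fin n) → lookup xs i ∈ toList xs
lookup∈toList xs i = ∈-toList⁺ (∈-lookup i xs)

∈⇒lookup : {xs : Vec A n} {a : A} → a ∈ᵛ xs → ∃[ i ] (a ≡ lookup xs i)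
∈⇒lookup a∈ = Anyᵛ.index a∈ , lookup-index a∈

staticRules : ∀ {k} → Vec Var k → (Fin k → Form) → List Rule
staticRules os φ = toList (tabulate λ i → static (lookup os i) (φ i))

allHeads-staticRules : ∀ {k} (os : Vec Var k) φ → allHeads (staticRules os φ) ≡ toList os
allHeads-staticRules []       φ = refl
allHeads-staticRules (o ∷ os) φ = cong (o ∷ˡ_) (allHeads-staticRules os (φ ∘ fsuc))

∈-staticRules⁺ : ∀ {k} (os : Vec Var k) φ i → static (lookup os i) (φ i) ∈ staticRules os φ
∈-staticRules⁺ os φ i =
  subst (_∈ staticRules os φ) (lookup∘tabulate _ i) (lookup∈toList _ i)

∈-staticRules⁻ : ∀ {k} (os : Vec Var k) φ {r} →
  r ∈ staticRules os φ → ∃[ i ] (r ≡ static (lookup os i) (φ i))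
∈-staticRules⁻ os φ r∈ with i , r≡ ← ∈⇒lookup (∈-toList⁻ r∈) = i , trans r≡ (lookup∘tabulate _ i)

override : Vec Var n → (Fin n → A) → (Var → A) → Var → A
override xs f ρ a with a ∈? xs
... | yes a∈xs = f (Anyᵛ.index a∈xs)
... | no  _    = ρ a

override-lookup : ∀ {xs : Vec Var n} (f : Fin n → A) ρ →
  Uniqueᵛ.Unique xs → ∀ i → override xs f ρ (lookup xs i) ≡ f i
override-lookup {xs = xs} f ρ u i with lookup xs i ∈? xs
... | yes p = cong f (sym (Uniqueᵛ.lookup-injective u i _ (lookup-index p)))
... | no ¬p = contradiction (∈-lookup i xs) ¬p

override-∉ : ∀ {xs : Vec Var n} (f : Fin n → A) ρ {a} → a ∉ᵛ xs → override xs f ρ a ≡ ρ a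
override-∉ {xs = xs} f ρ {a} a∉ with a ∈? xs
... | yes a∈ = contradiction a∈ a∉
... | no  _  = refl

TransClosure-ranked : ∀ {R : A → A → Set} (rank : A → ℕ) →
  (∀ {a b} → R a b → rank a < rank b) → ∀ {a b} → TransClosure R a b → rank a < rank b
TransClosure-ranked rank up [ r ]    = up r
TransClosure-ranked rank up (r ∷ rs) = <-trans (up r) (TransClosure-ranked rank up rs)

heads⊆vars : ∀ P {a} → a ∈ allHeads P → a ∈ vars P
heads⊆vars P a∈ =
  ∈-concatMap⁺ (λ r → heads r ++ body r) (Any.map ∈-++⁺ˡ (∈-concatMap⁻ heads {xs = P} a∈))

Holds⇔word≡ : ∀ {m s} (ρ : Var → Bool) (ins : Vec Var m) (I : Interp) σ →
  (∀ j → ρ (lookup ins j) ≡ I s (lookup ins j)) → Holds ρ ins σ ⇔ (word ins I s ≡ σ)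
Holds⇔word≡ ρ ins I σ reads = mk⇔
  (λ holds → trans (tabulate-cong λ j → trans (sym (reads j)) (holds j)) (tabulate∘lookup σ))
  (λ { refl j → trans (reads j) (sym (lookup∘tabulate _ j)) })

module _ {m} (𝒜 : OpAut m n) (ps : Vec Var n) (ins : Vec Var m) (I : Interp) (v : ℕ → Var → Bool)
         (reads : ∀ t j → v (suc t) (lookup ins j) ≡ I (suc t) (lookup ins j)) where
  open OpAut 𝒜

  private
    run : ℕ → Fin n
    run = opRun 𝒜 (word ins I)

  TracksRunAt : ℕ → Set
  TracksRunAt t = ∀ x → v t (lookup ps x) ≡ ⌊ run t ≟ x ⌋

  EntersAt : ℕ → Fin n → Set
  EntersAt t x = ∃[ j ] ∃[ σ ] (δ j σ ≡ x × v t (lookup ps j) ≡ true × Holds (v (suc t)) ins σ)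

  enters⇔run : ∀ {t x} → TracksRunAt t → EntersAt t x ⇔ (run (suc t) ≡ x)
  enters⇔run {t} {x} tracks = mk⇔ to from
    where
    to : EntersAt t x → run (suc t) ≡ x
    to (j , σ , δjσ≡x , pj , holds)
      with refl ← Equivalence.to (⌊⌋≡true⇔ (run t ≟ j)) (trans (sym (tracks j)) pj)
      with refl ← Equivalence.to (Holds⇔word≡ (v (suc t)) ins I σ (reads t)) holds
      = δjσ≡x
    from : run (suc t) ≡ x → EntersAt t x
    from run≡x = run t , word ins I (suc t) , run≡x
               , trans (tracks (run t)) (Equivalence.from (⌊⌋≡true⇔ (run t ≟ run t)) refl)
               , Equivalence.from (Holds⇔word≡ (v (suc t)) ins I _ (reads t)) refl

  dynamic⇒tracksRun : RuleSem v (dynamic 𝒜 ps ins) → ∀ t → TracksRunAt t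
  dynamic⇒tracksRun sem zero    x = proj₁ (sem x)
  dynamic⇒tracksRun sem (suc t) x =
    ≡⌊⌋ _ (run (suc t) ≟ x) (⇔.trans (proj₂ (sem x) t) (enters⇔run (dynamic⇒tracksRun sem t)))

  tracksRun⇒dynamic : (∀ t → TracksRunAt t) → RuleSem v (dynamic 𝒜 ps ins)
  tracksRun⇒dynamic tracks x = tracks 0 x , λ t →
    ⇔.trans (subst (λ b → (b ≡ true) ⇔ (run (suc t) ≡ x)) (sym (tracks (suc t) x))
                   (⌊⌋≡true⇔ (run (suc t) ≟ x)))
            (⇔.sym (enters⇔run (tracks t)))

inputValuation : Interp → ℕ → Var → Bool
inputValuation I zero    _ = false
inputValuation I (suc t) = I (suc t)

module MooreProgram {m k} (ins : Vec Var m) (outs : Vec Var k) (distinct : Unique (toList ins ++ toList outs))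
                    (𝒜 : OpAut m n) (label : Fin n → Vec Bool k) where

  base : ℕ
  base = suc (max 0 (toList ins ++ toList outs))

  states : Vec Var n
  states = tabulate (λ x → base + toℕ x)

  outputFormula : Fin k → Form
  outputFormula i = select (lookup states) (λ x → lookup (label x) i)

  program : Program
  program = dynamic 𝒜 states ins ∷ˡ staticRules outs outputFormula

  allHeads-program : allHeads program ≡ toList states ++ toList outs
  allHeads-program = cong (toList states ++_) (allHeads-staticRules outs outputFormula)

  below-base : ∀ {a} → a ∈ toList ins ++ toList outs → a < base
  below-base a∈ = s≤s (All.lookup (xs≤max 0 (toList ins ++ toList outs)) a∈)

  states-fresh : ∀ {a} → a ∈ toList ins ++ toList outs → a ∉ᵛ states
  states-fresh a∈ a∈states with x , refl ← ∈⇒lookup a∈states =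
    <-irrefl refl (<-≤-trans (below-base a∈) base≤state)
    where
    base≤state : base ≤ lookup states x
    base≤state = subst (base ≤_) (sym (lookup∘tabulate _ x)) (m≤m+n base (toℕ x))

  states-unique : Uniqueᵛ.Unique states
  states-unique = Uniqueᵛ.tabulate⁺ (toℕ-injective ∘ +-cancelˡ-≡ base _ _)

  outs-unique : Uniqueᵛ.Unique outs
  outs-unique = Unique-toList⁻ (Unique-++⁻ʳ (toList ins) distinct)

  in∉outs : ∀ {a} → a ∈ toList ins → a ∉ᵛ outs
  in∉outs a∈ins = Unique-++⇒disjoint (toList ins) distinct a∈ins ∘ ∈-toList⁺

  out∉states : ∀ i → lookup outs i ∉ᵛ states
  out∉states i = states-fresh (∈-++⁺ʳ (toList ins) (lookup∈toList outs i))

  in∉states : ∀ {a} → a ∈ toList ins → a ∉ᵛ states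
  in∉states = states-fresh ∘ ∈-++⁺ˡ

  isInput⇔ : ∀ {a} → IsInput program a ⇔ (a ∉ᵛ states × a ∉ᵛ outs)
  isInput⇔ {a} = mk⇔ (λ a∉ → a∉ ∘ state∈heads , a∉ ∘ out∈heads) λ (∉states , ∉outs) a∈ →
    [ ∉states ∘ ∈-toList⁻ , ∉outs ∘ ∈-toList⁻ ]′
      (∈-++⁻ (toList states) (subst (a ∈_) allHeads-program a∈))
    where
    state∈heads : a ∈ᵛ states → a ∈ allHeads program
    state∈heads a∈ = subst (a ∈_) (sym allHeads-program) (∈-++⁺ˡ (∈-toList⁺ a∈))
    out∈heads : a ∈ᵛ outs → a ∈ allHeads program
    out∈heads a∈ = subst (a ∈_) (sym allHeads-program) (∈-++⁺ʳ (toList states) (∈-toList⁺ a∈))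

  ins-input : ∀ j → IsInput program (lookup ins j)
  ins-input j = Equivalence.from isInput⇔ (in∉states ins∋ , in∉outs ins∋)
    where
    ins∋ : lookup ins j ∈ toList ins
    ins∋ = lookup∈toList ins j

  outs∈vars : ∀ i → lookup outs i ∈ vars program
  outs∈vars i = heads⊆vars program
    (subst (_ ∈_) (sym allHeads-program) (∈-++⁺ʳ (toList states) (lookup∈toList outs i)))

  layer : Var → ℕ
  layer = override states (λ _ → 1) (override outs (λ _ → 2) (λ _ → 0))

  layer-state : ∀ x → layer (lookup states x) ≡ 1
  layer-state = override-lookup _ _ states-unique

  layer-out : ∀ i → layer (lookup outs i) ≡ 2
  layer-out i = trans (override-∉ _ _ (out∉states i)) (override-lookup _ _ outs-unique i)

  layer-in : ∀ {a} → a ∈ toList ins → layer a ≡ 0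
  layer-in a∈ = trans (override-∉ _ _ (in∉states a∈)) (override-∉ _ _ (in∉outs a∈))

  layer-increases : ∀ {a b} → Edge program a b → layer a < layer b
  layer-increases (_ , here refl , a∈ins , b∈states)
    with x , refl ← ∈⇒lookup (∈-toList⁻ b∈states)
    rewrite layer-in a∈ins | layer-state x = s≤s z≤n
  layer-increases (_ , there r∈ , a∈φ , b∈heads)
    with i , refl ← ∈-staticRules⁻ outs outputFormula r∈
    with here refl ← b∈heads
    with x , refl ← formVars-select (lookup states) (λ x → lookup (label x) i) a∈φ
    rewrite layer-state x | layer-out i = s≤s (s≤s z≤n)

  isProgram : IsProgram program
  isProgram = nonrecursive , definitorial
    where
    nonrecursive : Nonrecursive program
    nonrecursive a cycle = <-irrefl refl (TransClosure-ranked layer layer-increases cycle)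
    definitorial : Definitorial program
    definitorial = subst Unique (sym allHeads-program)
      (Unique.++⁺ (Unique-toList⁺ states-unique) (Unique-++⁻ʳ (toList ins) distinct)
        λ (a∈states , a∈outs) → states-fresh (∈-++⁺ʳ (toList ins) a∈outs) (∈-toList⁻ a∈states))

  run : Interp → ℕ → Fin n
  run I = opRun 𝒜 (word ins I)

  canonical : Interp → ℕ → Var → Bool
  canonical I t = override states (λ x → ⌊ run I t ≟ x ⌋)
                    (override outs (λ i → lookup (label (run I t)) i) (inputValuation I t))

  canonical-state : ∀ I t x → canonical I t (lookup states x) ≡ ⌊ run I t ≟ x ⌋
  canonical-state I t = override-lookup _ _ states-unique

  canonical-out : ∀ I t i → canonical I t (lookup outs i) ≡ lookup (label (run I t)) i
  canonical-out I t i = trans (override-∉ _ _ (out∉states i)) (override-lookup _ _ outs-unique i)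

  canonical-input : ∀ I t {a} → IsInput program a → canonical I t a ≡ inputValuation I t a
  canonical-input I t a∉ with ∉states , ∉outs ← Equivalence.to isInput⇔ a∉ =
    trans (override-∉ _ _ ∉states) (override-∉ _ _ ∉outs)

  reads-inputs : ∀ I {v} → Model program I v → ∀ t j → v (suc t) (lookup ins j) ≡ I (suc t) (lookup ins j)
  reads-inputs I (inputs , _) t j = proj₂ (inputs _ (ins-input j)) t

  canonical-model : ∀ I → Model program I (canonical I)
  canonical-model I = (λ a a∉ → canonical-input I 0 a∉ , λ t → canonical-input I (suc t) a∉) , rules
    where
    reads : ∀ t j → canonical I (suc t) (lookup ins j) ≡ I (suc t) (lookup ins j)
    reads t j = canonical-input I (suc t) (ins-input j)
    rules : ∀ r → r ∈ program → RuleSem (canonical I) r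
    rules _ (here refl) = tracksRun⇒dynamic 𝒜 states ins I (canonical I) reads (canonical-state I)
    rules _ (there r∈) with i , refl ← ∈-staticRules⁻ outs outputFormula r∈ = λ t →
      trans (canonical-out I t i)
            (sym (eval-select-oneHot (canonical I t) (lookup states) _ (run I t) (canonical-state I t)))

  model-out : ∀ I {v} → Model program I v → ∀ t i → v t (lookup outs i) ≡ lookup (label (run I t)) i
  model-out I {v} model t i =
    trans (proj₂ model _ (there (∈-staticRules⁺ outs outputFormula i)) t)
          (eval-select-oneHot (v t) (lookup states) _ (run I t) (tracks t))
    where
    tracks : ∀ t → TracksRunAt 𝒜 states ins I v (reads-inputs I model) t
    tracks = dynamic⇒tracksRun 𝒜 states ins I v (reads-inputs I model) (proj₂ model _ (here refl))

  sat-out⇔ : ∀ I t i → Sat program I t (lookup outs i) ⇔ (lookup (label (run I t)) i ≡ true)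
  sat-out⇔ I t i = mk⇔
    (λ sat → trans (sym (canonical-out I t i)) (sat (canonical I) (canonical-model I)))
    (λ out v model → trans (model-out I model t i) out)

theorem4 : ∀ {m k} (ins : Vec Var m) (outs : Vec Var k) →
    Unique (toList ins ++ toList outs) →
    (C : Cascade (Vec Bool m) (Vec Bool k)) →
    ∃[ P ] (IsProgram P
    × (∀ j → IsInput P (lookup ins j))
    × (∀ i → lookup outs i ∈ vars P)
    × (∀ (I : Interp) (t : ℕ) → 1 ≤ t → ∀ (i : Fin k) →
    Derives (cascade C) ins I t i ⇔ Sat P I t (lookup outs i)))
theorem4 {k = k} ins outs distinct C = program , isProgram , ins-input , outs∈vars , correct
  where
  -- The initial remembered output is arbitrary: it is never read at times t ≥ 1.
  A⁺ : Automaton (Vec Bool _) (Vec Bool k)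
  A⁺ = withLastOutput (cascade C) (replicate k false)

  enumeration : Finite (Automaton.Q A⁺)
  enumeration = ×-finite (cascade-finite C) (Vec-finite Bool-finite k)

  open Inverse (proj₂ enumeration) using (to)
  open MooreProgram ins outs distinct (enumerate A⁺ (proj₂ enumeration)) (proj₂ ∘ to)

  correct : ∀ I t → 1 ≤ t → ∀ i → Derives (cascade C) ins I t i ⇔ Sat program I t (lookup outs i)
  correct I (suc t) _ i =
    subst (λ o → (lookup o i ≡ true) ⇔ Sat program I (suc t) (lookup outs i)) last-output
          (⇔.sym (sat-out⇔ I (suc t) i))
    where
    last-output : proj₂ (to (run I (suc t))) ≡ outAt (cascade C) (word ins I) (suc t)
    last-output = trans (cong proj₂ (to-opRun-enumerate A⁺ (proj₂ enumeration) (word ins I) (suc t)))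
                        (lastOutput-withLastOutput (cascade C) _ _ t)
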